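{- For every positive integer $n$, $$N_{3n}(\mathbb{Z})\leq\frac{5n^{2}+5n}{2},\qquad N_{3n+1}(\mathbb{Z})\leq\frac{5n^{2}+9n+2}{2},\qquad N_{3n+2}(\mathbb{Z})\leq\frac{5n^{2}+13n+6}{2}.$$
   Context: For a ring $R$, let $S(R):=\{a^{2} : a\in R\}$ denote the set of squares in $R$. For a subset $A\subseteq R$, the sumset is $A+A:=\{a+b : a,b\in A\}$. For a positive integer $n$, define $N_{n}(R):=\inf\{\,|A+A| : A\subseteq S(R),\ |A|=n\,\}$. -}

module Defs where

open import Data.Nat using (ℕ)
open import Data.Integer using (ℤ; _+_; _*_; _≟_)
open import Data.List using (List; length; deduplicate; cartesianProductWith)
open import Data.List.Relation.Unary.All using (All)
open import Data.List.Relation.Unary.Unique.Propositional using (Unique)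
open import Data.Product using (∃; _×_)
open import Relation.Binary.PropositionalEquality using (_≡_)

IsSquare : ℤ → Set
IsSquare a = ∃ λ b → a ≡ b * b

sumset : List ℤ → List ℤ
sumset A = deduplicate _≟_ (cartesianProductWith _+_ A A)

sumsetSize : List ℤ → ℕ
sumsetSize A = length (sumset A)

IsSquareSet : ℕ → List ℤ → Set
IsSquareSet n A = Unique A × All IsSquare A × length A ≡ n

-- N_n(ℤ) ≤ B.  N_n(ℤ) is an infimum of a set of naturals, hence (the set being nonempty
-- whenever we exhibit an element) N_n(ℤ) ≤ B iff some admissible A has |A+A| ≤ B.
N≤ : ℕ → ℕ → Set
N≤ n B = ∃ λ A → IsSquareSet n A × sumsetSize A Data.Nat.≤ B
  where import Data.Nat

module Submission where

-- An odd progression is a quadruple (a, b, c, d) with a, b, c odd, d even and nonzero,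
-- a² + d = b² and b² + d = c²: three odd squares in arithmetic progression.  The map
--   (a, b, c, d) ↦ (b⁴ − 2db² − d², b⁴ + d², b⁴ + 2db² − d², d·(2abc)²)
-- sends odd progressions to odd progressions; iterating it from (7, 13, 17, 120) gives
-- P₀, P₁, … with d_{j+e} = d_j·(2^e·o)² for some odd o.  Fixing K, each P_j (j ≤ K) is
-- rescaled by a square s_j² = (2^(K−j)·o)² to the common difference D = d_K, giving a
-- block {β_j − D, β_j, β_j + D} of squares, β_j = (s_j b_j)².  Blocks of different levels
-- are disjoint since their elements are 4^(K−j) times odd squares.
--
-- With n blocks of offsets {−1, 0, 1} the bound is
-- 5n(n+1)/2.  For 3n + 1 points the level-0 block also gets the offset 3
-- (13² + 3·120 = 23²); for 3n + 2 points a block with offsets {−1, 0} is added at the top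
-- level.

open import Defs
open import Data.Integer using (ℤ; +_; 0ℤ; 1ℤ; -1ℤ; _-_; ∣_∣; _^_; _≟_)
open import Data.Nat as ℕ using (ℕ; zero; suc; _∸_; _/_; _≤_; _<_; z≤n)
import Data.Nat.Properties as ℕP
open import Data.Nat.DivMod using (m*n/n≡m)
open import Data.List using (List; []; _∷_; _++_; map; concatMap; length; deduplicate; cartesianProductWith)
open import Data.List.Properties using (length-++; length-map)
open import Data.List.Membership.Propositional using (_∈_; find)
open import Data.List.Membership.Propositional.Properties
  using (∈-map⁺; ∈-map⁻; ∈-++⁺ˡ; ∈-++⁺ʳ; ∈-++⁻; ∈-∃++; ∈-concatMap⁺; ∈-concatMap⁻;
         ∈-deduplicate⁺; ∈-deduplicate⁻; ∈-cartesianProductWith⁺; ∈-cartesianProductWith⁻)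
open import Data.List.Relation.Binary.Disjoint.Propositional using (Disjoint)
open import Data.List.Relation.Unary.Any as Any using (here; there)
open import Data.List.Relation.Unary.All as All using (All; []; _∷_)
import Data.List.Relation.Unary.All.Properties as AllP
open import Data.List.Relation.Unary.AllPairs using (AllPairs; []; _∷_)
import Data.List.Relation.Unary.AllPairs.Properties as AllPairsP
open import Data.List.Relation.Unary.Unique.Propositional using (Unique)
import Data.List.Relation.Unary.Unique.Propositional.Properties as UniqueP
open import Data.List.Relation.Unary.Unique.DecPropositional.Properties _≟_ using (deduplicate-!)
open import Data.Product using (∃; ∃₂; _×_; _,_; proj₁; proj₂)
open import Function using (_∘_)
open import Data.Sum using (inj₁; inj₂)
open import Relation.Nullary using (contradiction)
open import Relation.Binary.PropositionalEquality
  using (_≡_; _≢_; refl; sym; trans; cong; cong₂; subst; module ≡-Reasoning)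

unique-⊆⇒length≤ : ∀ {A : Set} {xs ys : List A} →
                   Unique xs → (∀ {v} → v ∈ xs → v ∈ ys) → length xs ≤ length ys
unique-⊆⇒length≤ {xs = []} _ _ = z≤n
unique-⊆⇒length≤ {xs = x ∷ xs} (x∉xs ∷ xs!) xs⊆ys with ∈-∃++ (xs⊆ys (here refl))
... | us , vs , refl =
  ℕP.≤-trans (ℕ.s≤s (unique-⊆⇒length≤ xs! xs⊆us++vs)) (ℕP.≤-reflexive (sym length-split))
  where
  xs⊆us++vs : ∀ {v} → v ∈ xs → v ∈ us ++ vs
  xs⊆us++vs {v} v∈xs with ∈-++⁻ us (xs⊆ys (there v∈xs))
  ... | inj₁ v∈us         = ∈-++⁺ˡ v∈us
  ... | inj₂ (here refl)  = contradiction refl (All.lookup x∉xs v∈xs)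
  ... | inj₂ (there v∈vs) = ∈-++⁺ʳ us v∈vs
  length-split : length (us ++ x ∷ vs) ≡ suc (length (us ++ vs))
  length-split = trans (length-++ us)
    (trans (ℕP.+-suc (length us) (length vs)) (cong suc (sym (length-++ us))))

module Parity where
  open import Data.Integer using (_+_; _*_)
  open import Data.Integer.Properties using (abs-*; *-assoc; i*j≡0⇒i≡0∨j≡0; *-cancelˡ-≡)
  open import Data.Integer.Tactic.RingSolver using (solve-∀)

  Odd : ℤ → Set
  Odd x = ∃ λ q → x ≡ + 1 + + 2 * q

  Even : ℤ → Set
  Even x = ∃ λ q → x ≡ + 2 * q

  -- No integer is both odd and even (compare absolute values: 2|q − p| ≠ 1).
  odd≢even : ∀ p q → + 1 + + 2 * p ≢ + 2 * q
  odd≢even p q eq = ℕP.even≢odd ∣ q - p ∣ 0 (begin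
      2 ℕ.* ∣ q - p ∣                 ≡⟨ sym (abs-* (+ 2) (q - p)) ⟩
      ∣ + 2 * (q - p) ∣               ≡⟨ cong ∣_∣ twice-difference ⟩
      1                               ∎)
    where
    open ≡-Reasoning
    rearrange : ∀ p q → + 2 * (q - p) ≡ + 2 * q - (+ 1 + + 2 * p) + + 1
    rearrange = solve-∀
    cancel : ∀ q → + 2 * q - + 2 * q + + 1 ≡ + 1
    cancel = solve-∀
    twice-difference : + 2 * (q - p) ≡ + 1
    twice-difference = trans (rearrange p q) (trans (cong (λ z → + 2 * q - z + + 1) eq) (cancel q))

  odd≢0 : ∀ {x} → Odd x → x ≢ 0ℤ
  odd≢0 (p , refl) eq = odd≢even p 0ℤ eq

  odd*odd : ∀ {x y} → Odd x → Odd y → Odd (x * y)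
  odd*odd (p , refl) (q , refl) = p + q + + 2 * p * q , expand p q
    where
    expand : ∀ p q → (+ 1 + + 2 * p) * (+ 1 + + 2 * q) ≡ + 1 + + 2 * (p + q + + 2 * p * q)
    expand = solve-∀

  odd+even : ∀ {x y} → Odd x → Even y → Odd (x + y)
  odd+even (p , refl) (q , refl) = p + q , expand p q
    where
    expand : ∀ p q → (+ 1 + + 2 * p) + + 2 * q ≡ + 1 + + 2 * (p + q)
    expand = solve-∀

  odd-even : ∀ {x y} → Odd x → Even y → Odd (x - y)
  odd-even (p , refl) (q , refl) = p - q , expand p q
    where
    expand : ∀ p q → (+ 1 + + 2 * p) - + 2 * q ≡ + 1 + + 2 * (p - q)
    expand = solve-∀

  even*ʳ : ∀ {x} → Even x → ∀ y → Even (x * y)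
  even*ʳ (q , refl) y = q * y , *-assoc (+ 2) q y

  *-≢0 : ∀ {x y} → x ≢ 0ℤ → y ≢ 0ℤ → x * y ≢ 0ℤ
  *-≢0 {x} x≢0 y≢0 xy≡0 with i*j≡0⇒i≡0∨j≡0 x xy≡0
  ... | inj₁ x≡0 = x≢0 x≡0
  ... | inj₂ y≡0 = y≢0 y≡0

  private
    one-square : ∀ u → (+ 1 * u) * (+ 1 * u) ≡ u * u
    one-square = solve-∀
    even-square : ∀ P u → (+ 2 * P * u) * (+ 2 * P * u) ≡ + 2 * (+ 2 * P * u * P * u)
    even-square = solve-∀
    four-square : ∀ P u → (+ 2 * P * u) * (+ 2 * P * u) ≡ + 4 * ((P * u) * (P * u))
    four-square = solve-∀

  square-2-adic : ∀ m m' {u u'} → Odd u → Odd u' →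
                  ((+ 2) ^ m * u) * ((+ 2) ^ m * u) ≡ ((+ 2) ^ m' * u') * ((+ 2) ^ m' * u') → m ≡ m'
  square-2-adic zero zero _ _ _ = refl
  square-2-adic zero (suc m') {u} {u'} u-odd _ eq with odd*odd u-odd u-odd
  ... | q , u²≡ = contradiction
    (trans (sym u²≡) (trans (sym (one-square u)) (trans eq (even-square ((+ 2) ^ m') u'))))
    (odd≢even q _)
  square-2-adic (suc m) zero {u} {u'} _ u'-odd eq with odd*odd u'-odd u'-odd
  ... | q , u'²≡ = contradiction
    (trans (sym u'²≡) (trans (sym (one-square u')) (trans (sym eq) (even-square ((+ 2) ^ m) u))))
    (odd≢even q _)
  square-2-adic (suc m) (suc m') {u} {u'} u-odd u'-odd eq = cong suc (square-2-adic m m' u-odd u'-odd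
    (*-cancelˡ-≡ (+ 4) _ _ (trans (sym (four-square ((+ 2) ^ m) u)) (trans eq (four-square ((+ 2) ^ m') u')))))

open Parity

module OddProgressions where
  open import Data.Integer using (_+_; _*_)
  open import Data.Integer.Properties using (*-identityʳ)
  open import Data.Integer.Tactic.RingSolver using (solve-∀)

  record Progression : Set where
    constructor progression
    field a b c d : ℤ
  open Progression public

  record IsOddProgression (P : Progression) : Set where
    field
      lower  : a P * a P + d P ≡ b P * b P
      upper  : b P * b P + d P ≡ c P * c P
      odd-a  : Odd (a P)
      odd-b  : Odd (b P)
      odd-c  : Odd (c P)
      even-d : Even (d P)
      d≢0    : d P ≢ 0ℤ

  next : Progression → Progression
  next (progression a b c d) = progression
    (b * b * (b * b) - + 2 * d * (b * b) - d * d)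
    (b * b * (b * b) + d * d)
    (b * b * (b * b) + + 2 * d * (b * b) - d * d)
    (d * ((+ 2 * a * b * c) * (+ 2 * a * b * c)))

  private
    add-sub : ∀ x y → x ≡ x + y - y
    add-sub = solve-∀
    gap-expand : ∀ a b c d → d * ((+ 2 * a * b * c) * (+ 2 * a * b * c)) ≡ + 4 * d * (b * b) * ((a * a) * (c * c))
    gap-expand = solve-∀
    lower-identity : ∀ b d → (b * b * (b * b) - + 2 * d * (b * b) - d * d) * (b * b * (b * b) - + 2 * d * (b * b) - d * d)
      + + 4 * d * (b * b) * ((b * b - d) * (b * b + d)) ≡ (b * b * (b * b) + d * d) * (b * b * (b * b) + d * d)
    lower-identity = solve-∀
    upper-identity : ∀ b d → (b * b * (b * b) + d * d) * (b * b * (b * b) + d * d)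
      + + 4 * d * (b * b) * ((b * b - d) * (b * b + d)) ≡ (b * b * (b * b) + + 2 * d * (b * b) - d * d) * (b * b * (b * b) + + 2 * d * (b * b) - d * d)
    upper-identity = solve-∀

  -- Since a² = b² − d and c² = b² + d, the new difference is 4db²(b² − d)(b² + d),
  -- a polynomial in b and d alone; this is what makes the new triple a progression.
  next-gap : ∀ {P} → IsOddProgression P →
             d (next P) ≡ + 4 * d P * (b P * b P) * ((b P * b P - d P) * (b P * b P + d P))
  next-gap {progression a b c d} I = trans (gap-expand a b c d)
    (cong₂ (λ u v → + 4 * d * (b * b) * (u * v)) (trans (add-sub (a * a) d) (cong (_- d) lower)) (sym upper))
    where open IsOddProgression I

  next-preserves : ∀ {P} → IsOddProgression P → IsOddProgression (next P)
  next-preserves {progression a b c d} I = record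
    { lower  = trans (cong (λ z → Progression.a P′ * Progression.a P′ + z) (next-gap I)) (lower-identity b d)
    ; upper  = trans (cong (λ z → Progression.b P′ * Progression.b P′ + z) (next-gap I)) (upper-identity b d)
    ; odd-a  = odd-even (odd-even b⁴-odd (even*ʳ (d , refl) (b * b))) (even*ʳ even-d d)
    ; odd-b  = odd+even b⁴-odd (even*ʳ even-d d)
    ; odd-c  = odd-even (odd+even b⁴-odd (even*ʳ (d , refl) (b * b))) (even*ʳ even-d d)
    ; even-d = even*ʳ even-d _
    ; d≢0    = *-≢0 d≢0 (*-≢0 2abc≢0 2abc≢0)
    }
    where
    open IsOddProgression I
    P′ = next (progression a b c d)
    b⁴-odd : Odd (b * b * (b * b))
    b⁴-odd = odd*odd (odd*odd odd-b odd-b) (odd*odd odd-b odd-b)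
    2abc≢0 : + 2 * a * b * c ≢ 0ℤ
    2abc≢0 = *-≢0 (*-≢0 (*-≢0 {+ 2} (λ ()) (odd≢0 odd-a)) (odd≢0 odd-b)) (odd≢0 odd-c)

  progressions : ℕ → Progression
  progressions zero    = progression (+ 7) (+ 13) (+ 17) (+ 120)
  progressions (suc j) = next (progressions j)

  progressions-odd : ∀ j → IsOddProgression (progressions j)
  progressions-odd zero = record
    { lower = refl ; upper = refl ; odd-a = + 3 , refl ; odd-b = + 6 , refl ; odd-c = + 8 , refl
    ; even-d = + 60 , refl ; d≢0 = λ () }
  progressions-odd (suc j) = next-preserves (progressions-odd j)

  -- Odd part of the factor relating the differences of levels j and j + e.
  oddPart : ℕ → ℕ → ℤ
  oddPart j zero    = + 1
  oddPart j (suc e) = a (progressions j) * b (progressions j) * c (progressions j) * oddPart (suc j) e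

  oddPart-odd : ∀ j e → Odd (oddPart j e)
  oddPart-odd j zero    = 0ℤ , refl
  oddPart-odd j (suc e) = odd*odd (odd*odd (odd*odd odd-a odd-b) odd-c) (oddPart-odd (suc j) e)
    where open IsOddProgression (progressions-odd j)

  private
    rescale-step : ∀ d a b c P O → d * ((+ 2 * a * b * c) * (+ 2 * a * b * c)) * ((P * O) * (P * O))
                   ≡ d * ((+ 2 * P * (a * b * c * O)) * (+ 2 * P * (a * b * c * O)))
    rescale-step = solve-∀

  gap-rescaling : ∀ j e → d (progressions (j ℕ.+ e)) ≡ d (progressions j) * (((+ 2) ^ e * oddPart j e) * ((+ 2) ^ e * oddPart j e))
  gap-rescaling j zero rewrite ℕP.+-identityʳ j = sym (*-identityʳ _)
  gap-rescaling j (suc e) rewrite ℕP.+-suc j e =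
    trans (gap-rescaling (suc j) e) (rescale-step (d P) (a P) (b P) (c P) ((+ 2) ^ e) (oddPart (suc j) e))
    where P = progressions j

open OddProgressions

-- A block is a level j together with a list O of offsets; it will stand for the points
-- β_j + εD, ε ∈ O.
Block : Set
Block = ℕ × List ℤ

level : Block → ℕ
level = proj₁

offsets : Block → List ℤ
offsets = proj₂

-- The offsets used: a whole progression {−1, 0, 1}; at level 0 additionally 3, since
-- 13² + 3·120 = 23²; and the lower half {−1, 0}.
progressionOffsets extendedOffsets lowerOffsets : List ℤ
progressionOffsets = -1ℤ ∷ 0ℤ ∷ 1ℤ ∷ []
extendedOffsets    = -1ℤ ∷ 0ℤ ∷ 1ℤ ∷ + 3 ∷ []
lowerOffsets       = -1ℤ ∷ 0ℤ ∷ []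

progressionOffsets-unique : Unique progressionOffsets
progressionOffsets-unique = ((λ ()) ∷ (λ ()) ∷ []) ∷ ((λ ()) ∷ []) ∷ [] ∷ []

extendedOffsets-unique : Unique extendedOffsets
extendedOffsets-unique =
  ((λ ()) ∷ (λ ()) ∷ (λ ()) ∷ []) ∷ ((λ ()) ∷ (λ ()) ∷ []) ∷ ((λ ()) ∷ []) ∷ [] ∷ []

lowerOffsets-unique : Unique lowerOffsets
lowerOffsets-unique = ((λ ()) ∷ []) ∷ [] ∷ []

run : ℕ → ℕ → List Block
run s zero    = []
run s (suc r) = (s , progressionOffsets) ∷ run (suc s) r

-- Sets made of blocks {β_j + εD : ε ∈ O_j} with a common difference D, and a list
-- covering their sumset: sums of two points lie in β_j + β_k + (O_j + O_k)·D.
module BlockSets (β : ℕ → ℤ) (D : ℤ) where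
  open import Data.Integer using (_+_; _*_)
  open import Data.Integer.Properties using (+-0-abelianGroup; *-cancelʳ-≡; +-comm)
  open import Data.Integer.Base using (≢-nonZero)
  open import Algebra.Bundles using (AbelianGroup)
  open import Algebra.Properties.Group (AbelianGroup.group +-0-abelianGroup) using (∙-cancelˡ)
  open import Data.Integer.Tactic.RingSolver using (solve-∀)

  point : ℕ → ℤ → ℤ
  point j ε = β j + ε * D

  blockPoints : Block → List ℤ
  blockPoints p = map (point (level p)) (offsets p)

  points : List Block → List ℤ
  points = concatMap blockPoints

  offsetSums : List ℤ → List ℤ → List ℤ
  offsetSums O O' = deduplicate _≟_ (cartesianProductWith _+_ O O')

  blockSums : Block → Block → List ℤ
  blockSums p q = map (λ t → β (level p) + β (level q) + t * D) (offsetSums (offsets p) (offsets q))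

  -- one entry per unordered pair of blocks (the first block of each pair listed first)
  pairSums : List Block → List ℤ
  pairSums []       = []
  pairSums (p ∷ ps) = concatMap (blockSums p) (p ∷ ps) ++ pairSums ps

  point-injective : D ≢ 0ℤ → ∀ j {ε ε'} → point j ε ≡ point j ε' → ε ≡ ε'
  point-injective D≢0 j {ε} {ε'} eq = *-cancelʳ-≡ ε ε' D {{≢-nonZero D≢0}} (∙-cancelˡ (β j) (ε * D) (ε' * D) eq)

  points-unique : D ≢ 0ℤ → ∀ {bs} → All (Unique ∘ offsets) bs →
                  AllPairs (λ p q → Disjoint (blockPoints p) (blockPoints q)) bs → Unique (points bs)
  points-unique D≢0 offsets-unique disjoint = UniqueP.concat⁺
    (AllP.map⁺ (All.map (λ {p} → UniqueP.map⁺ (point-injective D≢0 (level p))) offsets-unique))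
    (AllPairsP.map⁺ disjoint)

  points-∈ : ∀ bs {v} → v ∈ points bs → ∃₂ λ p ε → p ∈ bs × ε ∈ offsets p × v ≡ point (level p) ε
  points-∈ bs v∈ with find (∈-concatMap⁻ blockPoints v∈)
  ... | p , p∈bs , v∈p with ∈-map⁻ (point (level p)) v∈p
  ...   | ε , ε∈ , refl = p , ε , p∈bs , ε∈ , refl

  private
    regroup : ∀ x y e e' δ → (x + e * δ) + (y + e' * δ) ≡ x + y + (e + e') * δ
    regroup = solve-∀

  blockSums-∈ : ∀ p q {ε ε'} → ε ∈ offsets p → ε' ∈ offsets q →
                point (level p) ε + point (level q) ε' ∈ blockSums p q
  blockSums-∈ p q {ε} {ε'} ε∈ ε'∈ = subst (_∈ blockSums p q) (sym (regroup (β (level p)) (β (level q)) ε ε' D))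
    (∈-map⁺ _ (∈-deduplicate⁺ _≟_ (∈-cartesianProductWith⁺ _+_ ε∈ ε'∈)))

  cross-∈ : ∀ p {q qs ε ε'} → q ∈ qs → ε ∈ offsets p → ε' ∈ offsets q →
            point (level p) ε + point (level q) ε' ∈ concatMap (blockSums p) qs
  cross-∈ p q∈ ε∈ ε'∈ = ∈-concatMap⁺ (blockSums p) (Any.map (λ { refl → blockSums-∈ p _ ε∈ ε'∈ }) q∈)

  pairSums-∈ : ∀ bs {p q ε ε'} → p ∈ bs → q ∈ bs → ε ∈ offsets p → ε' ∈ offsets q →
               point (level p) ε + point (level q) ε' ∈ pairSums bs
  pairSums-∈ (b ∷ bs) (here refl) q∈ ε∈ ε'∈ = ∈-++⁺ˡ (cross-∈ b q∈ ε∈ ε'∈)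
  pairSums-∈ (b ∷ bs) {p} {ε = ε} {ε'} (there p∈) (here refl) ε∈ ε'∈ =
    subst (_∈ pairSums (b ∷ bs)) (+-comm (point (level b) ε') (point (level p) ε))
      (∈-++⁺ˡ (cross-∈ b (there p∈) ε'∈ ε∈))
  pairSums-∈ (b ∷ bs) (there p∈) (there q∈) ε∈ ε'∈ =
    ∈-++⁺ʳ (concatMap (blockSums b) (b ∷ bs)) (pairSums-∈ bs p∈ q∈ ε∈ ε'∈)

  sumset-⊆ : ∀ bs {v} → v ∈ sumset (points bs) → v ∈ pairSums bs
  sumset-⊆ bs v∈ with ∈-cartesianProductWith⁻ _+_ (points bs) (points bs) (∈-deduplicate⁻ _≟_ _ v∈)
  ... | x , y , x∈ , y∈ , refl with points-∈ bs x∈ | points-∈ bs y∈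
  ...   | p , ε , p∈ , ε∈ , refl | q , ε' , q∈ , ε'∈ , refl = pairSums-∈ bs p∈ q∈ ε∈ ε'∈

  sumsetSize-≤ : ∀ bs → sumsetSize (points bs) ≤ length (pairSums bs)
  sumsetSize-≤ bs = unique-⊆⇒length≤ (deduplicate-! _) (sumset-⊆ bs)


module Construction (K : ℕ) where
  open import Data.Integer using (_+_; _*_)
  open import Data.Integer.Tactic.RingSolver using (solve-∀)

  D : ℤ
  D = d (progressions K)

  scale : ℕ → ℤ
  scale j = (+ 2) ^ (K ∸ j) * oddPart j (K ∸ j)

  base : ℕ → ℤ
  base j = (scale j * b (progressions j)) * (scale j * b (progressions j))

  open BlockSets base D public

  D-rescaled : ∀ {j} → j ≤ K → D ≡ d (progressions j) * (scale j * scale j)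
  D-rescaled {j} j≤K =
    trans (cong (d ∘ progressions) (sym (ℕP.m+[n∸m]≡n j≤K))) (gap-rescaling j (K ∸ j))

  Admissible : ℕ → ℤ → Set
  Admissible j ε = ∃ λ x → Odd x × b (progressions j) * b (progressions j) + ε * d (progressions j) ≡ x * x

  private
    factor-scale : ∀ P O y ε δ → (P * O * y) * (P * O * y) + ε * (δ * ((P * O) * (P * O)))
                   ≡ (P * O) * (P * O) * (y * y + ε * δ)
    factor-scale = solve-∀
    regroup-square : ∀ P O x → (P * O) * (P * O) * (x * x) ≡ (P * (O * x)) * (P * (O * x))
    regroup-square = solve-∀

  point-square : ∀ {j ε} → j ≤ K → Admissible j ε →
                 ∃ λ u → Odd u × point j ε ≡ ((+ 2) ^ (K ∸ j) * u) * ((+ 2) ^ (K ∸ j) * u)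
  point-square {j} {ε} j≤K (x , x-odd , bε≡x²) =
    oddPart j (K ∸ j) * x , odd*odd (oddPart-odd j (K ∸ j)) x-odd , (begin
      base j + ε * D                                    ≡⟨ cong (λ δ → base j + ε * δ) (D-rescaled j≤K) ⟩
      base j + ε * (d P * (scale j * scale j))          ≡⟨ factor-scale 2^e O (b P) ε (d P) ⟩
      scale j * scale j * (b P * b P + ε * d P)         ≡⟨ cong (scale j * scale j *_) bε≡x² ⟩
      scale j * scale j * (x * x)                       ≡⟨ regroup-square 2^e O x ⟩
      (2^e * (O * x)) * (2^e * (O * x))                 ∎)
    where
    open ≡-Reasoning
    P = progressions j
    2^e = (+ 2) ^ (K ∸ j)
    O = oddPart j (K ∸ j)

  level-separation : ∀ {j k ε ε'} → j ≤ K → k ≤ K → Admissible j ε → Admissible k ε' →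
                     point j ε ≡ point k ε' → j ≡ k
  level-separation {j} {k} {ε} {ε'} j≤K k≤K adm adm' eq
    with point-square {j} {ε} j≤K adm | point-square {k} {ε'} k≤K adm'
  ... | u , u-odd , eq₁ | u' , u'-odd , eq₂ =
    trans (sym (ℕP.m∸[m∸n]≡n j≤K)) (trans (cong (K ∸_) same-depth) (ℕP.m∸[m∸n]≡n k≤K))
    where
    same-depth : K ∸ j ≡ K ∸ k
    same-depth = square-2-adic (K ∸ j) (K ∸ k) u-odd u'-odd (trans (sym eq₁) (trans eq eq₂))

  private
    remove-zero : ∀ x y → x + 0ℤ * y ≡ x
    remove-zero = solve-∀
    add-one : ∀ x y → x + 1ℤ * y ≡ x + y
    add-one = solve-∀
    subtract-one : ∀ x y → x + y + -1ℤ * y ≡ x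
    subtract-one = solve-∀

  module _ (j : ℕ) where
    open IsOddProgression (progressions-odd j)
    private P = progressions j

    progression-admissible : ∀ {ε} → ε ∈ progressionOffsets → Admissible j ε
    progression-admissible (here refl) =
      a P , odd-a , trans (cong (λ y → y + -1ℤ * d P) (sym lower)) (subtract-one (a P * a P) (d P))
    progression-admissible (there (here refl)) =
      b P , odd-b , remove-zero (b P * b P) (d P)
    progression-admissible (there (there (here refl))) =
      c P , odd-c , trans (add-one (b P * b P) (d P)) upper

  -- At level 0 also 13² + 3·120 = 23².
  extended-admissible : ∀ {ε} → ε ∈ extendedOffsets → Admissible 0 ε
  extended-admissible (here refl)                       = progression-admissible 0 (here refl)
  extended-admissible (there (here refl))               = progression-admissible 0 (there (here refl))
  extended-admissible (there (there (here refl)))       = progression-admissible 0 (there (there (here refl)))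
  extended-admissible (there (there (there (here refl)))) = + 23 , (+ 11 , refl) , refl

  lower-admissible : ∀ j {ε} → ε ∈ lowerOffsets → Admissible j ε
  lower-admissible j (here refl)         = progression-admissible j (here refl)
  lower-admissible j (there (here refl)) = progression-admissible j (there (here refl))

  record GoodBlock (p : Block) : Set where
    field
      bounded    : level p ≤ K
      unique     : Unique (offsets p)
      admissible : ∀ {ε} → ε ∈ offsets p → Admissible (level p) ε
  open GoodBlock

  good-disjoint : ∀ {p q} → GoodBlock p → GoodBlock q → level p ≢ level q →
                  Disjoint (blockPoints p) (blockPoints q)
  good-disjoint {p} {q} gp gq j≢k (v∈p , v∈q)
    with ∈-map⁻ (point (level p)) v∈p | ∈-map⁻ (point (level q)) v∈q
  ... | ε , ε∈ , refl | ε' , ε'∈ , eq =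
    j≢k (level-separation {ε = ε} {ε'} (bounded gp) (bounded gq) (admissible gp ε∈) (admissible gq ε'∈) eq)

  good-separated : ∀ {bs} → All GoodBlock bs → AllPairs (λ p q → level p ≢ level q) bs →
                   AllPairs (λ p q → Disjoint (blockPoints p) (blockPoints q)) bs
  good-separated []       []       = []
  good-separated (g ∷ gs) (h ∷ hs) =
    All.zipWith (λ (g' , h') {v} → good-disjoint g g' h' {v}) (gs , h) ∷ good-separated gs hs

  good-squares : ∀ {p} → GoodBlock p → All IsSquare (blockPoints p)
  good-squares {p} g = AllP.map⁺ (All.tabulate λ {ε} ε∈ →
    let (u , _ , eq) = point-square {level p} {ε} (bounded g) (admissible g ε∈) in (+ 2) ^ (K ∸ level p) * u , eq)

  realise : ∀ bs → All GoodBlock bs → AllPairs (λ p q → level p ≢ level q) bs →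
            N≤ (length (points bs)) (length (pairSums bs))
  realise bs goods distinct =
    points bs ,
    (points-unique D≢0 (All.map unique goods) (good-separated goods distinct) ,
     AllP.concat⁺ (AllP.map⁺ (All.map good-squares goods)) , refl) ,
    sumsetSize-≤ bs
    where D≢0 = IsOddProgression.d≢0 (progressions-odd K)

open import Data.Nat using (_+_; _*_)
open import Data.Nat.Tactic.RingSolver using (solve-∀)

module Counting (β : ℕ → ℤ) (D : ℤ) where
  open BlockSets β D

  length-points-cons : ∀ p bs → length (points (p ∷ bs)) ≡ length (offsets p) + length (points bs)
  length-points-cons p bs =
    trans (length-++ (blockPoints p)) (cong (_+ length (points bs)) (length-map (point (level p)) (offsets p)))

  length-points-run : ∀ s r → length (points (run s r)) ≡ 3 * r
  length-points-run s zero    = refl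
  length-points-run s (suc r) =
    trans (length-points-cons (s , progressionOffsets) (run (suc s) r))
      (trans (cong (λ n → 3 + n) (length-points-run (suc s) r)) (sym (ℕP.*-suc 3 r)))

  length-cross-run : ∀ p s r → length (concatMap (blockSums p) (run s r))
                              ≡ r * length (offsetSums (offsets p) progressionOffsets)
  length-cross-run p s zero    = refl
  length-cross-run p s (suc r) =
    trans (length-++ (blockSums p q))
      (cong₂ _+_ (length-map _ (offsetSums (offsets p) progressionOffsets)) (length-cross-run p (suc s) r))
    where q = (s , progressionOffsets)

  length-pairSums-cons : ∀ p bs → length (pairSums (p ∷ bs))
    ≡ length (offsetSums (offsets p) (offsets p)) + length (concatMap (blockSums p) bs) + length (pairSums bs)
  length-pairSums-cons p bs = begin
    length ((blockSums p p ++ concatMap (blockSums p) bs) ++ pairSums bs)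
      ≡⟨ length-++ (blockSums p p ++ _) ⟩
    length (blockSums p p ++ concatMap (blockSums p) bs) + length (pairSums bs)
      ≡⟨ cong (_+ length (pairSums bs)) (length-++ (blockSums p p)) ⟩
    length (blockSums p p) + length (concatMap (blockSums p) bs) + length (pairSums bs)
      ≡⟨ cong (λ n → n + length (concatMap (blockSums p) bs) + length (pairSums bs)) (length-map _ (offsetSums (offsets p) (offsets p))) ⟩
    length (offsetSums (offsets p) (offsets p)) + length (concatMap (blockSums p) bs) + length (pairSums bs) ∎
    where open ≡-Reasoning

  private
    double-cons : ∀ a r b L → 2 * (a + r * b + L) ≡ 2 * a + 2 * (r * b) + 2 * L
    double-cons = solve-∀
    triangle-step : ∀ r → 2 * 5 + 2 * (r * 5) + 5 * (r * suc r) ≡ 5 * (suc r * suc (suc r))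
    triangle-step = solve-∀

  mutual
    -- A run of r full progressions: each of the r(r+1)/2 pairs contributes {−2, …, 2}.
    pairSums-run : ∀ s r → 2 * length (pairSums (run s r)) ≡ 5 * (r * suc r)
    pairSums-run s zero    = refl
    pairSums-run s (suc r) = trans (pairSums-before-run (s , progressionOffsets) (suc s) r) (triangle-step r)

    pairSums-before-run : ∀ p s r → 2 * length (pairSums (p ∷ run s r))
      ≡ 2 * length (offsetSums (offsets p) (offsets p))
        + 2 * (r * length (offsetSums (offsets p) progressionOffsets)) + 5 * (r * suc r)
    pairSums-before-run p s r = begin
      2 * length (pairSums (p ∷ run s r))
        ≡⟨ cong (2 *_) (length-pairSums-cons p (run s r)) ⟩
      2 * (length (offsetSums O O) + length (concatMap (blockSums p) (run s r)) + length (pairSums (run s r)))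
        ≡⟨ cong (λ n → 2 * (length (offsetSums O O) + n + length (pairSums (run s r)))) (length-cross-run p s r) ⟩
      2 * (length (offsetSums O O) + r * length (offsetSums O progressionOffsets) + length (pairSums (run s r)))
        ≡⟨ double-cons (length (offsetSums O O)) r (length (offsetSums O progressionOffsets)) (length (pairSums (run s r))) ⟩
      2 * length (offsetSums O O) + 2 * (r * length (offsetSums O progressionOffsets)) + 2 * length (pairSums (run s r))
        ≡⟨ cong (λ n → 2 * length (offsetSums O O) + 2 * (r * length (offsetSums O progressionOffsets)) + n) (pairSums-run s r) ⟩
      2 * length (offsetSums O O) + 2 * (r * length (offsetSums O progressionOffsets)) + 5 * (r * suc r) ∎
      where
      open ≡-Reasoning
      O = offsets p

run-above : ∀ s r {t} → t ≤ s → All (λ p → t ≤ level p) (run s r)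
run-above s zero    t≤s = []
run-above s (suc r) t≤s = t≤s ∷ run-above (suc s) r (ℕP.m≤n⇒m≤1+n t≤s)

run-below : ∀ s r → All (λ p → level p < s + r) (run s r)
run-below s zero    = []
run-below s (suc r) = ℕP.m<m+n s ℕP.0<1+n
  ∷ subst (λ n → All (λ p → level p < n) (run (suc s) r)) (sym (ℕP.+-suc s r)) (run-below (suc s) r)

run-distinct : ∀ s r → AllPairs (λ p q → level p ≢ level q) (run s r)
run-distinct s zero    = []
run-distinct s (suc r) = All.map ℕP.<⇒≢ (run-above (suc s) r ℕP.≤-refl) ∷ run-distinct (suc s) r

run-good : ∀ K s r → s + r ≤ K → All (Construction.GoodBlock K) (run s r)
run-good K s zero    _       = []
run-good K s (suc r) s+r<K = record
  { bounded = ℕP.≤-trans (ℕP.m≤m+n s (suc r)) s+r<K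
  ; unique = progressionOffsets-unique
  ; admissible = Construction.progression-admissible K s }
  ∷ run-good K (suc s) r (subst (_≤ K) (ℕP.+-suc s r) s+r<K)

N≤-rewrite : ∀ {N L N' num} → N≤ N L → N ≡ N' → 2 * L ≡ num → N≤ N' (num / 2)
N≤-rewrite {N} {L} {num = num} bound refl 2L≡num = subst (N≤ N) (sym half) bound
  where
  half : num / 2 ≡ L
  half = trans (cong (_/ 2) (trans (sym 2L≡num) (ℕP.*-comm 2 L))) (m*n/n≡m L 2)

N-3n : ∀ m → N≤ (3 * suc m) ((5 * (suc m * suc m) + 5 * suc m) / 2)
N-3n m = N≤-rewrite
  (realise (run 0 k) (run-good k 0 k ℕP.≤-refl) (run-distinct 0 k))
  (length-points-run 0 k)
  (trans (pairSums-run 0 k) (arithmetic k))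
  where
  k = suc m
  open Construction k
  open Counting base D
  arithmetic : ∀ k → 5 * (k * suc k) ≡ 5 * (k * k) + 5 * k
  arithmetic = solve-∀

N-3n+1 : ∀ m → N≤ (3 * suc m + 1) ((5 * (suc m * suc m) + 9 * suc m + 2) / 2)
N-3n+1 m = N≤-rewrite
  (realise bs (first ∷ run-good k 1 m ℕP.≤-refl)
              (All.map ℕP.<⇒≢ (run-above 1 m ℕP.≤-refl) ∷ run-distinct 1 m))
  (trans (length-points-cons (0 , extendedOffsets) (run 1 m)) (trans (cong (λ n → 4 + n) (length-points-run 1 m)) (size m)))
  (trans (pairSums-before-run (0 , extendedOffsets) 1 m) (arithmetic m))
  where
  k = suc m
  open Construction k
  open Counting base D
  bs = (0 , extendedOffsets) ∷ run 1 m
  first : GoodBlock (0 , extendedOffsets)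
  first = record { bounded = z≤n ; unique = extendedOffsets-unique ; admissible = extended-admissible }
  size : ∀ m → 4 + 3 * m ≡ 3 * suc m + 1
  size = solve-∀
  arithmetic : ∀ m → 2 * 8 + 2 * (m * 7) + 5 * (m * suc m) ≡ 5 * (suc m * suc m) + 9 * suc m + 2
  arithmetic = solve-∀

N-3n+2 : ∀ m → N≤ (3 * suc m + 2) ((5 * (suc m * suc m) + 13 * suc m + 6) / 2)
N-3n+2 m = N≤-rewrite
  (realise bs (top ∷ run-good k 0 k ℕP.≤-refl)
              (All.map (λ j<k k≡j → ℕP.<⇒≢ j<k (sym k≡j)) (run-below 0 k) ∷ run-distinct 0 k))
  (trans (length-points-cons (k , lowerOffsets) (run 0 k)) (trans (cong (λ n → 2 + n) (length-points-run 0 k)) (ℕP.+-comm 2 (3 * k))))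
  (trans (pairSums-before-run (k , lowerOffsets) 0 k) (arithmetic k))
  where
  k = suc m
  open Construction k
  open Counting base D
  bs = (k , lowerOffsets) ∷ run 0 k
  top : GoodBlock (k , lowerOffsets)
  top = record { bounded = ℕP.≤-refl ; unique = lowerOffsets-unique ; admissible = lower-admissible k }
  arithmetic : ∀ k → 2 * 3 + 2 * (k * 4) + 5 * (k * suc k) ≡ 5 * (k * k) + 13 * k + 6
  arithmetic = solve-∀

mainTheorem7 : (m : ℕ) →
    N≤ (3 * suc m) ((5 * (suc m * suc m) + 5 * suc m) / 2) ×
    N≤ (3 * suc m + 1) ((5 * (suc m * suc m) + 9 * suc m + 2) / 2) ×
    N≤ (3 * suc m + 2) ((5 * (suc m * suc m) + 13 * suc m + 6) / 2)
mainTheorem7 m = N-3n m , N-3n+1 m , N-3n+2 m
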